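{- Let $m,n$ be integers with $n\ge m$ and $n\equiv 2,3,\ldots,m-1 \pmod{m+1}$. Then $\chi_{=}^*(K_m\times K_n)<\chi_{=}^*(K_{m(n)})$.
   Context: All graphs are finite, simple, undirected. For a positive integer $k$, a (proper) $k$-coloring of a graph $G$ is a map $f:V(G)\to\{1,\dots,k\}$ with $f(x)\ne f(y)$ whenever $xy\in E(G)$; its color classes are the sets $f^{ -1}(i)$, $i=1,\dots,k$. For a positive integer $r$, an $r$-equitable $k$-coloring is a $k$-coloring in which any two color classes differ in size by at most $r$. The $r$-equitable chromatic threshold $\chi_{r=}^*(G)$ is the smallest integer $k$ such that $G$ has an $r$-equitable $k'$-coloring for every $k'\ge k$; $\chi_{=}^*(G)$ denotes $\chi_{1=}^*(G)$. The Kronecker product $G\times H$ has vertex set $V(G)\times V(H)$, with $(x,y)(x',y')$ an edge iff $xx'\in E(G)$ and $yy'\in E(H)$. $K_{m(n)}$ denotes the complete $m$-partite graph with $n$ vertices in each part. -}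

module Defs where

open import Data.Nat using (ℕ; zero; suc; _+_; _*_; _∸_; _≤_; _<_)
open import Data.Fin using (Fin; remQuot)
open import Data.Fin.Properties using (_≟_)
open import Data.List using (List; length; filter; allFin)
open import Data.Product using (Σ; _×_; proj₁; proj₂)
open import Relation.Binary.PropositionalEquality using (_≡_)
open import Relation.Nullary using (¬_)

record Graph : Set₁ where
  field
    N   : ℕ
    Adj : Fin N → Fin N → Set
open Graph public

IsColoring : (G : Graph) (k : ℕ) → (Fin (N G) → Fin k) → Set
IsColoring G k f = ∀ x y → Adj G x y → ¬ (f x ≡ f y)

classSize : ∀ {V k} → (Fin V → Fin k) → Fin k → ℕ
classSize {V} f i = length (filter (λ v → f v ≟ i) (allFin V))

IsEquitableColoring : ℕ → (G : Graph) (k : ℕ) → (Fin (N G) → Fin k) → Set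
IsEquitableColoring r G k f =
  IsColoring G k f × (∀ i j → classSize f i ≤ classSize f j + r)

HasEquitableColoring : ℕ → Graph → ℕ → Set
HasEquitableColoring r G k = Σ (Fin (N G) → Fin k) (IsEquitableColoring r G k)

EquitableFrom : ℕ → Graph → ℕ → Set
EquitableFrom r G k = ∀ k' → k ≤ k' → HasEquitableColoring r G k'

IsEqThreshold : ℕ → Graph → ℕ → Set
IsEqThreshold r G k =
  1 ≤ k × EquitableFrom r G k × (∀ j → 1 ≤ j → j < k → ¬ EquitableFrom r G j)

-- K_m × K_n (Kronecker product), vertex v ↔ remQuot n v : Fin m × Fin n
KmxKn : ℕ → ℕ → Graph
KmxKn m n = record
  { N = m * n
  ; Adj = λ u v → ¬ (proj₁ (remQuot {m} n u) ≡ proj₁ (remQuot {m} n v))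
                × ¬ (proj₂ (remQuot {m} n u) ≡ proj₂ (remQuot {m} n v)) }

Kmn-partite : ℕ → ℕ → Graph
Kmn-partite m n = record
  { N = m * n
  ; Adj = λ u v → ¬ (proj₁ (remQuot {m} n u) ≡ proj₁ (remQuot {m} n v)) }

-- Write n = q(m+1) + r with 0 < r < m.  In an equitable colouring of K_{m(n)}
-- every colour class lies inside one part, so each part is cut into some
-- number c_i of classes of sizes σ or σ + 1, σ being the least class size.
-- With m(q+1) − 1 colours some part has c_i ≤ q, which forces σ > m, and then
-- the classes hold more than mn vertices; so χ*_=(K_{m(n)}) = b ≥ m(q+1).
-- Comparing the equitable b-colouring with the failure at b − 1 shows b = m·c
-- with c = ⌈n/(σ+1)⌉ > q and σ ≤ m.  Proper colourings of K_m × K_n include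
-- those of K_{m(n)} and also "column" classes, one cell from each of several
-- rows: letting s + 1 rows share s column colours and use c − 1 colours of
-- their own, and the other rows c colours each, gives an equitable
-- (b − 1)-colouring of K_m × K_n.

module Submission where

open import Defs
open import Data.Bool.Base using (true; false; if_then_else_)
open import Data.Empty using (⊥-elim)
open import Data.Fin.Base as Fin using (Fin; zero; suc; toℕ; _↑ˡ_; _↑ʳ_; splitAt; join; remQuot; inject≤; finToFun; funToFin)
open import Data.Fin.Properties as Finₚ using (_≟_; any?; all?; toℕ-injective; toℕ-fromℕ<; toℕ<n; toℕ-↑ˡ; toℕ-↑ʳ; remQuot-combine; finToFun-funToFin; +↔⊎; *↔×; splitAt-↑ˡ; splitAt-↑ʳ; join-splitAt)
open import Data.List.Base using (length; filter; tabulate)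
open import Data.Nat using (ℕ; suc; _∸_; _≤_; _<_; _%_)
open import Data.Nat.Base
open import Data.Nat.DivMod using (_mod_; m≡m%n+[m/n]*n; m%n<n; m%n≤m; m/n*n≤m; [m+n]%n≡m%n; [m+kn]%n≡m%n; m<n⇒m%n≡m; m*n%n≡0)
open import Data.Nat.Properties hiding (_≟_)
open import Data.Nat.Tactic.RingSolver using (solve-∀)
open import Data.Product using (Σ-syntax; _×_)
open import Data.Product.Base using (Σ; ∃; _,_; proj₁; proj₂)
open import Data.Product.Properties using (,-injective; ,-injectiveˡ)
open import Data.Sum.Base using (_⊎_; inj₁; inj₂; [_,_]′)
open import Data.Sum.Properties using (inj₁-injective; inj₂-injective)
open import Data.Sum.Function.Propositional using (_⊎-↔_)
open import Function.Base using (_∘_; id)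
open import Function.Bundles using (_↔_; Inverse)
open import Function.Construct.Composition using (_↔-∘_)
open import Function.Construct.Identity using (↔-id)
open import Relation.Binary.PropositionalEquality
open import Relation.Nullary using (Dec; does; _because_; yes; no; ¬_; ¬?; _×-dec_; _→-dec_; contradiction)
open import Relation.Nullary.Decidable using (map′; decidable-stable)
open import Relation.Unary using (Pred; Decidable)
open import Algebra.Properties.Semiring.Sum +-*-semiring
  using (sum; sum-syntax; sum-cong-≗; ∑-comm; *-distribˡ-sum; *-distribʳ-sum)

-- Defined through `does`, so that it computes under `map′` and Fin's `_≟_`.
𝟙 : ∀ {p} {P : Set p} → Dec P → ℕ
𝟙 d = if does d then 1 else 0

module _ {p} {P : Set p} where

  𝟙-yes : P → (d : Dec P) → 𝟙 d ≡ 1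
  𝟙-yes p (yes _) = refl
  𝟙-yes p (no ¬p) = ⊥-elim (¬p p)

  𝟙-no : ¬ P → (d : Dec P) → 𝟙 d ≡ 0
  𝟙-no ¬p (yes p) = ⊥-elim (¬p p)
  𝟙-no ¬p (no _) = refl

  𝟙-cong : ∀ {q} {Q : Set q} → (P → Q) → (Q → P) → (d : Dec P) (e : Dec Q) → 𝟙 d ≡ 𝟙 e
  𝟙-cong P→Q Q→P d (yes q) = 𝟙-yes (Q→P q) d
  𝟙-cong P→Q Q→P d (no ¬q) = 𝟙-no (¬q ∘ P→Q) d

𝟙-×-dec : ∀ {p q} {P : Set p} {Q : Set q} (d : Dec P) (e : Dec Q) → 𝟙 (d ×-dec e) ≡ 𝟙 d * 𝟙 e
𝟙-×-dec (true  because _) (true  because _) = refl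
𝟙-×-dec (true  because _) (false because _) = refl
𝟙-×-dec (false because _) _                 = refl

∑-const : ∀ N c → ∑[ i < N ] c ≡ N * c
∑-const zero    c = refl
∑-const (suc N) c = cong (c +_) (∑-const N c)

∑-zero : ∀ {N} (f : Fin N → ℕ) → (∀ i → f i ≡ 0) → sum f ≡ 0
∑-zero {N} f f≗0 = trans (sum-cong-≗ f≗0) (trans (∑-const N 0) (*-zeroʳ N))

∑-mono-≤ : ∀ {N} {f g : Fin N → ℕ} → (∀ i → f i ≤ g i) → sum f ≤ sum g
∑-mono-≤ {zero}  f≤g = z≤n
∑-mono-≤ {suc N} f≤g = +-mono-≤ (f≤g zero) (∑-mono-≤ (f≤g ∘ suc))

pigeonhole-> : ∀ {M} (f : Fin M → ℕ) d → M * d < sum f → Σ[ i ∈ Fin M ] d < f i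
pigeonhole-> {M} f d Md<∑f with any? (λ i → d <? f i)
... | yes found = found
... | no  none  =
  contradiction Md<∑f (≤⇒≯ (subst (sum f ≤_) (∑-const M d) (∑-mono-≤ λ i → ≮⇒≥ λ d<fi → none (i , d<fi))))

pigeonhole-< : ∀ {M} (f : Fin M → ℕ) a → sum f < M * a → Σ[ i ∈ Fin M ] f i < a
pigeonhole-< {M} f a ∑f<Ma with any? (λ i → f i <? a)
... | yes found = found
... | no  none  =
  contradiction ∑f<Ma (≤⇒≯ (subst (_≤ sum f) (∑-const M a) (∑-mono-≤ λ i → ≮⇒≥ λ fi<a → none (i , fi<a))))

*≤∑ : ∀ {M} (f : Fin M → ℕ) c → (∀ i → c ≤ f i) → M * c ≤ sum f
*≤∑ {M} f c c≤f = subst (_≤ sum f) (∑-const M c) (∑-mono-≤ c≤f)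

∑-*-≤ : ∀ {M} (f : Fin M → ℕ) σ n → (∀ i → f i * σ ≤ n) → sum f * σ ≤ M * n
∑-*-≤ {M} f σ n f*σ≤n = begin
  sum f * σ             ≡⟨ *-distribʳ-sum σ f ⟩
  ∑[ i < M ] (f i * σ)  ≤⟨ ∑-mono-≤ f*σ≤n ⟩
  ∑[ i < M ] n          ≡⟨ ∑-const M n ⟩
  M * n                 ∎
  where open ≤-Reasoning

∑-↑ : ∀ a b (f : Fin (a + b) → ℕ) → sum f ≡ ∑[ i < a ] f (i ↑ˡ b) + ∑[ j < b ] f (a ↑ʳ j)
∑-↑ zero    b f = refl
∑-↑ (suc a) b f = trans (cong (f zero +_) (∑-↑ a b (f ∘ suc))) (sym (+-assoc (f zero) _ _))

∑-combine : ∀ m n (f : Fin (m * n) → ℕ) → sum f ≡ ∑[ i < m ] ∑[ x < n ] f (Fin.combine i x)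
∑-combine zero    n f = refl
∑-combine (suc m) n f = trans (∑-↑ n (m * n) f) (cong (∑[ x < n ] f (x ↑ˡ m * n) +_) (∑-combine m n (f ∘ (n ↑ʳ_))))

∑-remQuot : ∀ m n (F : Fin m × Fin n → ℕ) → ∑[ v < m * n ] F (remQuot {m} n v) ≡ ∑[ i < m ] ∑[ x < n ] F (i , x)
∑-remQuot m n F = trans (∑-combine m n _) (sum-cong-≗ λ i → sum-cong-≗ λ x → cong F (remQuot-combine i x))

∑-𝟙≟ʳ : ∀ {N} (j : Fin N) → ∑[ i < N ] 𝟙 (i ≟ j) ≡ 1
∑-𝟙≟ʳ {suc N} zero    = cong suc (∑-zero {N} _ λ i → refl)
∑-𝟙≟ʳ {suc N} (suc j) = ∑-𝟙≟ʳ j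

𝟙-≟-sym : ∀ {N} (i j : Fin N) → 𝟙 (i ≟ j) ≡ 𝟙 (j ≟ i)
𝟙-≟-sym i j = 𝟙-cong sym sym (i ≟ j) (j ≟ i)

∑-𝟙≟ˡ : ∀ {N} (j : Fin N) → ∑[ i < N ] 𝟙 (j ≟ i) ≡ 1
∑-𝟙≟ˡ j = trans (sum-cong-≗ λ i → 𝟙-≟-sym j i) (∑-𝟙≟ʳ j)

∑-𝟙≟-sift : ∀ {N} (j : Fin N) (f : Fin N → ℕ) → ∑[ i < N ] (𝟙 (i ≟ j) * f i) ≡ f j
∑-𝟙≟-sift {suc N} zero    f =
  trans (cong (f zero + 0 +_) (∑-zero {N} _ λ i → refl)) (trans (+-identityʳ _) (+-identityʳ _))
∑-𝟙≟-sift {suc N} (suc j) f = ∑-𝟙≟-sift j (f ∘ suc)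

length-filter-tabulate : ∀ {a p} {A : Set a} {P : Pred A p} (P? : Decidable P) {V} (g : Fin V → A) →
                         length (filter P? (tabulate g)) ≡ ∑[ v < V ] 𝟙 (P? (g v))
length-filter-tabulate P? {zero}  g = refl
length-filter-tabulate P? {suc V} g with does (P? (g zero))
... | true  = cong suc (length-filter-tabulate P? (g ∘ suc))
... | false = length-filter-tabulate P? (g ∘ suc)

module _ {V k} (f : Fin V → Fin k) where

  classSize≡∑ : ∀ i → classSize f i ≡ ∑[ v < V ] 𝟙 (f v ≟ i)
  classSize≡∑ i = length-filter-tabulate (λ v → f v ≟ i) id

  classSize-injective : (∀ {u v} → f u ≡ f v → u ≡ v) → ∀ i → classSize f i ≤ 1
  classSize-injective f-inj i = subst (_≤ 1) (sym (classSize≡∑ i)) (∑-𝟙-injective f f-inj)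
    where
    ∑-𝟙-injective : ∀ {V} (g : Fin V → Fin k) → (∀ {u v} → g u ≡ g v → u ≡ v) → ∑[ v < V ] 𝟙 (g v ≟ i) ≤ 1
    ∑-𝟙-injective {zero}  g g-inj = z≤n
    ∑-𝟙-injective {suc V} g g-inj with g zero ≟ i
    ... | yes g0≡i = ≤-reflexive (cong suc (∑-zero {V} _ λ v →
                       𝟙-no (λ gv≡i → Finₚ.0≢1+n (g-inj (trans g0≡i (sym gv≡i)))) (g (suc v) ≟ i)))
    ... | no _     = ∑-𝟙-injective (g ∘ suc) (Finₚ.suc-injective ∘ g-inj)

classSize-cong : ∀ {V k} {f g : Fin V → Fin k} → (∀ v → f v ≡ g v) → ∀ i → classSize f i ≡ classSize g i
classSize-cong {f = f} {g} f≗g i = begin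
  classSize f i             ≡⟨ classSize≡∑ f i ⟩
  ∑[ v < _ ] 𝟙 (f v ≟ i)    ≡⟨ sum-cong-≗ (λ v → cong (λ c → 𝟙 (c ≟ i)) (f≗g v)) ⟩
  ∑[ v < _ ] 𝟙 (g v ≟ i)    ≡⟨ classSize≡∑ g i ⟨
  classSize g i             ∎
  where open ≡-Reasoning

∃-fun? : ∀ {p} {N k} {P : (Fin N → Fin k) → Set p} →
         (∀ {f g} → (∀ v → f v ≡ g v) → P f → P g) → (∀ f → Dec (P f)) → Dec (∃ P)
∃-fun? resp P? = map′ (λ (i , p) → finToFun i , p)
                      (λ (f , p) → funToFin f , resp (sym ∘ finToFun-funToFin f) p)
                      (any? (P? ∘ finToFun))

module _ (r : ℕ) (G : Graph) where

  HasEquitableColoring? : (∀ x y → Dec (Adj G x y)) → ∀ k → Dec (HasEquitableColoring r G k)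
  HasEquitableColoring? Adj? k = ∃-fun? ≗-resp λ f →
      all? (λ x → all? (λ y → Adj? x y →-dec ¬? (f x ≟ f y)))
    ×-dec all? (λ i → all? (λ j → classSize f i ≤? classSize f j + r))
    where
    ≗-resp : ∀ {f g} → (∀ v → f v ≡ g v) → IsEquitableColoring r G k f → IsEquitableColoring r G k g
    ≗-resp f≗g (proper , balanced) =
      (λ x y xy gx≡gy → proper x y xy (trans (f≗g x) (trans gx≡gy (sym (f≗g y))))) ,
      (λ i j → subst₂ (λ a b → a ≤ b + r) (classSize-cong f≗g i) (classSize-cong f≗g j) (balanced i j))

  HasEquitableColoring-≥ : 1 ≤ r → (∀ x → ¬ Adj G x x) → ∀ k → N G ≤ k → HasEquitableColoring r G k
  HasEquitableColoring-≥ 1≤r irrefl k N≤k = f , proper , balanced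
    where
    f : Fin (N G) → Fin k
    f v = inject≤ v N≤k
    f-inj : ∀ {u v} → f u ≡ f v → u ≡ v
    f-inj = Finₚ.inject≤-injective N≤k N≤k _ _
    proper : IsColoring G k f
    proper x y xy fx≡fy = irrefl x (subst (Adj G x) (sym (f-inj fx≡fy)) xy)
    balanced : ∀ i j → classSize f i ≤ classSize f j + r
    balanced i j = ≤-trans (classSize-injective f f-inj i) (≤-trans 1≤r (m≤n+m r _))

  EquitableFrom-pred : ∀ {k} → EquitableFrom r G (suc k) → HasEquitableColoring r G k → EquitableFrom r G k
  EquitableFrom-pred {k} from1+k at-k k' k≤k' with m≤n⇒m<n∨m≡n k≤k'
  ... | inj₁ k<k' = from1+k k' k<k'
  ... | inj₂ refl = at-k

  module _ (Adj? : ∀ x y → Dec (Adj G x y)) where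

    EquitableFrom⇒threshold : ∀ B → EquitableFrom r G (suc B) → Σ ℕ (IsEqThreshold r G)
    EquitableFrom⇒threshold zero    from1 = 1 , ≤-refl , from1 , λ j 1≤j j<1 → contradiction 1≤j (<⇒≱ j<1)
    EquitableFrom⇒threshold (suc B) from2+B with HasEquitableColoring? Adj? (suc B)
    ... | yes at1+B = EquitableFrom⇒threshold B (EquitableFrom-pred from2+B at1+B)
    ... | no ¬at1+B = suc (suc B) , s≤s z≤n , from2+B ,
                      λ j _ j<2+B fromj → ¬at1+B (fromj (suc B) (s≤s⁻¹ j<2+B))

    threshold-exists : 1 ≤ r → (∀ x → ¬ Adj G x x) → Σ ℕ (IsEqThreshold r G)
    threshold-exists 1≤r irrefl = EquitableFrom⇒threshold (N G) λ k 1+N≤k →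
      HasEquitableColoring-≥ 1≤r irrefl k (≤-trans (n≤1+n _) 1+N≤k)

  ¬equitable⇒<threshold : ∀ {b k} → IsEqThreshold r G b → ¬ HasEquitableColoring r G k → k < b
  ¬equitable⇒<threshold {b} {k} (_ , from-b , _) ¬at-k = ≰⇒> λ b≤k → ¬at-k (from-b k b≤k)

  ¬equitable-pred-threshold : ∀ {b} → IsEqThreshold r G (suc b) → 1 ≤ b → ¬ HasEquitableColoring r G b
  ¬equitable-pred-threshold {b} (_ , from1+b , least) 1≤b at-b = least b 1≤b ≤-refl (EquitableFrom-pred from1+b at-b)

threshold-< : ∀ {r} {G H : Graph} {a b} → IsEqThreshold r G a → IsEqThreshold r H (suc b) →
              (∀ {k} → HasEquitableColoring r H k → HasEquitableColoring r G k) →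
              1 ≤ b → HasEquitableColoring r G b → a < suc b
threshold-< {r} {G} {a = a} {b} (_ , _ , least) (_ , from1+b , _) H⇒G 1≤b at-b with a ≤? b
... | yes a≤b = s≤s a≤b
... | no  a≰b = contradiction (EquitableFrom-pred r G (λ k 1+b≤k → H⇒G (from1+b k 1+b≤k)) at-b) (least b 1≤b (≰⇒> a≰b))

KmxKn-Adj? : ∀ m n x y → Dec (Adj (KmxKn m n) x y)
KmxKn-Adj? m n x y = ¬? (_ ≟ _) ×-dec ¬? (_ ≟ _)

Kmn-partite-Adj? : ∀ m n x y → Dec (Adj (Kmn-partite m n) x y)
Kmn-partite-Adj? m n x y = ¬? (_ ≟ _)

KmxKn-irreflexive : ∀ {m n} x → ¬ Adj (KmxKn m n) x x
KmxKn-irreflexive x (different-row , _) = different-row refl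

Kmn-partite-irreflexive : ∀ {m n} x → ¬ Adj (Kmn-partite m n) x x
Kmn-partite-irreflexive x different-part = different-part refl

Kmn-partite⇒KmxKn : ∀ {r m n k} → HasEquitableColoring r (Kmn-partite m n) k → HasEquitableColoring r (KmxKn m n) k
Kmn-partite⇒KmxKn (f , proper , balanced) = f , (λ u v u≁v → proper u v (proj₁ u≁v)) , balanced

-- Splitting a number into nearly equal terms

Near : ℕ → ℕ → Set
Near t x = t ≤ x × x ≤ suc t

-- n is a sum of c terms, each equal to t or t + 1.
Splits : ℕ → ℕ → ℕ → Set
Splits c t n = c * t ≤ n × n ≤ c * suc t

Fin⇒>0 : ∀ {n} → Fin n → 0 < n
Fin⇒>0 Fin.zero    = z<s
Fin⇒>0 (Fin.suc _) = z<s

Near⇒balanced : ∀ {k t} (s : Fin k → ℕ) → (∀ i → Near t (s i)) → ∀ i j → s i ≤ s j + 1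
Near⇒balanced {t = t} s near i j = ≤-trans (proj₂ (near i)) (subst (_≤ s j + 1) (+-comm t 1) (+-monoˡ-≤ 1 (proj₁ (near j))))

module Residues (g : ℕ) .{{_ : NonZero g}} (j : Fin g) where

  mod-cong : ∀ {a b} → a % g ≡ b % g → a mod g ≡ b mod g
  mod-cong {a} {b} a≡b = toℕ-injective (trans (toℕ-fromℕ< _) (trans a≡b (sym (toℕ-fromℕ< _))))

  count : ℕ → ℕ
  count L = ∑[ x < L ] 𝟙 (toℕ x mod g ≟ j)

  count-+ : ∀ a b → count (a + b) ≡ count a + ∑[ y < b ] 𝟙 ((a + toℕ y) mod g ≟ j)
  count-+ a b = begin
    count (a + b)                                                                 ≡⟨ ∑-↑ a b _ ⟩
    ∑[ x < a ] 𝟙 (toℕ (x ↑ˡ b) mod g ≟ j) + ∑[ y < b ] 𝟙 (toℕ (a ↑ʳ y) mod g ≟ j)  ≡⟨ cong₂ _+_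
      (sum-cong-≗ {a} λ x → cong (λ z → 𝟙 (z mod g ≟ j)) (toℕ-↑ˡ x b))
      (sum-cong-≗ {b} λ y → cong (λ z → 𝟙 (z mod g ≟ j)) (toℕ-↑ʳ a y)) ⟩
    count a + ∑[ y < b ] 𝟙 ((a + toℕ y) mod g ≟ j)                                ∎
    where open ≡-Reasoning

  count-period : count g ≡ 1
  count-period = trans (sum-cong-≗ {g} λ x → cong (λ c → 𝟙 (c ≟ j)) (toℕ-mod x)) (∑-𝟙≟ʳ j)
    where
    toℕ-mod : ∀ (x : Fin g) → toℕ x mod g ≡ x
    toℕ-mod x = toℕ-injective (trans (toℕ-fromℕ< _) (m<n⇒m%n≡m (toℕ<n x)))

  count-shift : ∀ L → count (g + L) ≡ suc (count L)
  count-shift L = begin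
    count (g + L)                                       ≡⟨ count-+ g L ⟩
    count g + ∑[ y < L ] 𝟙 ((g + toℕ y) mod g ≟ j)     ≡⟨ cong₂ _+_ count-period (sum-cong-≗ {L} λ y →
                                                             cong (λ c → 𝟙 (c ≟ j)) (mod-cong (g+a%g≡a%g (toℕ y)))) ⟩
    suc (count L)                                       ∎
    where
    open ≡-Reasoning
    g+a%g≡a%g : ∀ a → (g + a) % g ≡ a % g
    g+a%g≡a%g a = trans (cong (_% g) (+-comm g a)) ([m+n]%n≡m%n a g)

  count-mono : ∀ a b → count a ≤ count (a + b)
  count-mono a b = subst (count a ≤_) (sym (count-+ a b)) (m≤m+n _ _)

  count-* : ∀ t e → count (g * t + e) ≡ t + count e
  count-* zero    e = cong count (cong (_+ e) (*-zeroʳ g))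
  count-* (suc t) e = begin
    count (g * suc t + e)  ≡⟨ cong count (trans (cong (_+ e) (*-suc g t)) (+-assoc g (g * t) e)) ⟩
    count (g + (g * t + e)) ≡⟨ count-shift (g * t + e) ⟩
    suc (count (g * t + e)) ≡⟨ cong suc (count-* t e) ⟩
    suc t + count e         ∎
    where open ≡-Reasoning

  count-near : ∀ {t L} → Splits g t L → Near t (count L)
  count-near {t} {L} (gt≤L , L≤g[1+t]) =
    subst (Near t) (sym count-L) (m≤m+n t _ , subst (t + count e ≤_) (+-comm t 1) (+-monoʳ-≤ t count-e≤1))
    where
    e = L ∸ g * t
    L≡ : g * t + e ≡ L
    L≡ = m+[n∸m]≡n gt≤L
    e≤g : e ≤ g
    e≤g = +-cancelˡ-≤ (g * t) e g (subst₂ _≤_ (sym L≡) (trans (*-suc g t) (+-comm g (g * t))) L≤g[1+t])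
    count-L : count L ≡ t + count e
    count-L = trans (cong count (sym L≡)) (count-* t e)
    count-e≤1 : count e ≤ 1
    count-e≤1 = subst (count e ≤_) (trans (cong count (m+[n∸m]≡n e≤g)) count-period) (count-mono e (g ∸ e))

-- Equitable colourings of K_{m(n)}

∑-Splits : ∀ {k σ} (w s : Fin k → ℕ) → (∀ c → Near σ (s c)) → Splits (sum w) σ (∑[ c < k ] (w c * s c))
∑-Splits {k} {σ} w s near =
  subst (_≤ ∑[ c < k ] (w c * s c)) (sym (*-distribʳ-sum σ w)) (∑-mono-≤ λ c → *-monoʳ-≤ (w c) (proj₁ (near c))) ,
  subst (∑[ c < k ] (w c * s c) ≤_) (sym (*-distribʳ-sum (suc σ) w)) (∑-mono-≤ λ c → *-monoʳ-≤ (w c) (proj₂ (near c)))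

classSize-∘ : ∀ {V k m} (f : Fin V → Fin k) (ρ : Fin k → Fin m) i →
              classSize (ρ ∘ f) i ≡ ∑[ c < k ] (𝟙 (ρ c ≟ i) * classSize f c)
classSize-∘ {V} {k} f ρ i = begin
  classSize (ρ ∘ f) i                                   ≡⟨ classSize≡∑ (ρ ∘ f) i ⟩
  ∑[ v < V ] 𝟙 (ρ (f v) ≟ i)                            ≡⟨ sum-cong-≗ {V} (λ v → ∑-𝟙≟-sift (f v) (λ c → 𝟙 (ρ c ≟ i))) ⟨
  ∑[ v < V ] ∑[ c < k ] (𝟙 (c ≟ f v) * 𝟙 (ρ c ≟ i))     ≡⟨ ∑-comm (λ v c → 𝟙 (c ≟ f v) * 𝟙 (ρ c ≟ i)) ⟩
  ∑[ c < k ] ∑[ v < V ] (𝟙 (c ≟ f v) * 𝟙 (ρ c ≟ i))     ≡⟨ sum-cong-≗ {k} (λ c → begin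
      ∑[ v < V ] (𝟙 (c ≟ f v) * 𝟙 (ρ c ≟ i))  ≡⟨ *-distribʳ-sum (𝟙 (ρ c ≟ i)) (λ v → 𝟙 (c ≟ f v)) ⟨
      ∑[ v < V ] 𝟙 (c ≟ f v) * 𝟙 (ρ c ≟ i)    ≡⟨ cong (_* 𝟙 (ρ c ≟ i)) (sum-cong-≗ {V} λ v → 𝟙-≟-sym c (f v)) ⟩
      ∑[ v < V ] 𝟙 (f v ≟ c) * 𝟙 (ρ c ≟ i)    ≡⟨ *-comm (∑[ v < V ] 𝟙 (f v ≟ c)) _ ⟩
      𝟙 (ρ c ≟ i) * ∑[ v < V ] 𝟙 (f v ≟ c)    ≡⟨ cong (𝟙 (ρ c ≟ i) *_) (classSize≡∑ f c) ⟨
      𝟙 (ρ c ≟ i) * classSize f c             ∎) ⟩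
  ∑[ c < k ] (𝟙 (ρ c ≟ i) * classSize f c)               ∎
  where open ≡-Reasoning

classSize-part : ∀ m n (i : Fin m) → classSize (λ v → proj₁ (remQuot {m} n v)) i ≡ n
classSize-part m n i = begin
  classSize (λ v → proj₁ (remQuot {m} n v)) i  ≡⟨ classSize≡∑ (λ v → proj₁ (remQuot {m} n v)) i ⟩
  ∑[ v < m * n ] 𝟙 (proj₁ (remQuot {m} n v) ≟ i) ≡⟨ ∑-remQuot m n (λ p → 𝟙 (proj₁ p ≟ i)) ⟩
  ∑[ i′ < m ] ∑[ x < n ] 𝟙 (i′ ≟ i)             ≡⟨ sum-cong-≗ {m} (λ i′ → trans (∑-const n _) (*-comm n _)) ⟩
  ∑[ i′ < m ] (𝟙 (i′ ≟ i) * n)                  ≡⟨ ∑-𝟙≟-sift i (λ _ → n) ⟩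
  n                                             ∎
  where open ≡-Reasoning

argmin : ∀ {k} (s : Fin (suc k) → ℕ) → Σ[ i ∈ Fin (suc k) ] ∀ j → s i ≤ s j
argmin {zero}  s = zero , λ { zero → ≤-refl }
argmin {suc k} s with argmin (s ∘ suc)
... | i , min with s zero ≤? s (suc i)
...   | yes s0≤ = zero  , λ { zero → ≤-refl ; (suc j) → ≤-trans s0≤ (min j) }
...   | no  s0≰ = suc i , λ { zero → <⇒≤ (≰⇒> s0≰) ; (suc j) → min j }

Near-min : ∀ {k} (s : Fin k → ℕ) → (∀ i j → s i ≤ s j + 1) → Σ[ σ ∈ ℕ ] ∀ i → Near σ (s i)
Near-min {zero}  s balanced = 0 , λ ()
Near-min {suc k} s balanced = let i₀ , min = argmin s in
  s i₀ , λ i → min i , subst (s i ≤_) (+-comm (s i₀) 1) (balanced i i₀)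

record Splitting (m n k : ℕ) : Set where
  field
    σ          : ℕ
    classesIn  : Fin m → ℕ
    ∑classesIn : sum classesIn ≡ k
    splits     : ∀ i → Splits (classesIn i) σ n

equitable⇒Splitting : ∀ {m n k} → HasEquitableColoring 1 (Kmn-partite (suc m) n) k → Splitting (suc m) n k
equitable⇒Splitting {m} {n} {k} (f , proper , balanced) = record
  { σ = σ ; classesIn = classesIn ; ∑classesIn = ∑classesIn ; splits = splits }
  where
  part : Fin (suc m * n) → Fin (suc m)
  part v = proj₁ (remQuot {suc m} n v)

  classes-near = Near-min (classSize f) balanced
  σ = proj₁ classes-near

  -- An empty class contributes nothing, so its part is arbitrary.
  partOf : Fin k → Fin (suc m)
  partOf c with any? (λ v → f v ≟ c)
  ... | yes (v , _) = part v
  ... | no _        = zero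

  partOf-f : ∀ v → partOf (f v) ≡ part v
  partOf-f v with any? (λ u → f u ≟ f v)
  ... | yes (u , fu≡fv) = decidable-stable (part u ≟ part v) (λ u≁v → proper u v u≁v fu≡fv)
  ... | no ∄u           = contradiction (v , refl) ∄u

  classesIn : Fin (suc m) → ℕ
  classesIn i = ∑[ c < k ] 𝟙 (partOf c ≟ i)

  ∑classesIn : sum classesIn ≡ k
  ∑classesIn = begin
    ∑[ i < suc m ] ∑[ c < k ] 𝟙 (partOf c ≟ i) ≡⟨ ∑-comm (λ i c → 𝟙 (partOf c ≟ i)) ⟩
    ∑[ c < k ] ∑[ i < suc m ] 𝟙 (partOf c ≟ i) ≡⟨ sum-cong-≗ {k} (λ c → ∑-𝟙≟ˡ (partOf c)) ⟩
    ∑[ c < k ] 1                               ≡⟨ trans (∑-const k 1) (*-identityʳ k) ⟩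
    k                                          ∎
    where open ≡-Reasoning

  splits : ∀ i → Splits (classesIn i) σ n
  splits i = subst (Splits (classesIn i) σ) part-size
    (∑-Splits (λ c → 𝟙 (partOf c ≟ i)) (classSize f) (proj₂ classes-near))
    where
    open ≡-Reasoning
    part-size : ∑[ c < k ] (𝟙 (partOf c ≟ i) * classSize f c) ≡ n
    part-size = begin
      ∑[ c < k ] (𝟙 (partOf c ≟ i) * classSize f c) ≡⟨ classSize-∘ f partOf i ⟨
      classSize (partOf ∘ f) i                      ≡⟨ classSize-cong partOf-f i ⟩
      classSize part i                              ≡⟨ classSize-part (suc m) n i ⟩
      n                                             ∎

-- Block colourings

splitAt-injective : ∀ m {n} {i j : Fin (m + n)} → splitAt m i ≡ splitAt m j → i ≡ j
splitAt-injective m {n} {i} {j} eq = trans (sym (join-splitAt m n i)) (trans (cong (join m n) eq) (join-splitAt m n j))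

-- A column class {(i , x) | i < h} (x < w) is independent in K_m × K_n but not
-- in K_{m(n)}, which therefore only gets the case w = 0.
module BlockColoring (h h′ w w′ g c t : ℕ) .{{_ : NonZero g}} .{{_ : NonZero c}}
                     (columns : 0 < w → Near t h)
                     (top     : 0 < h → Splits g t w′)
                     (bottom  : 0 < h′ → Splits c t (w + w′)) where

  m = h + h′
  n = w + w′
  k = w + (h * g + h′ * c)

  Color : Set
  Color = Fin w ⊎ (Fin h × Fin g ⊎ Fin h′ × Fin c)

  palette : Fin k ↔ Color
  palette = (↔-id _ ⊎-↔ ((*↔× ⊎-↔ *↔×) ↔-∘ +↔⊎)) ↔-∘ +↔⊎

  open Inverse palette using (to; from; inverseˡ; inverseʳ)

  from≡⇒≡to : ∀ {a i} → from a ≡ i → a ≡ to i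
  from≡⇒≡to eq = sym (inverseˡ (sym eq))

  ≡to⇒from≡ : ∀ {a i} → a ≡ to i → from a ≡ i
  ≡to⇒from≡ = inverseʳ

  from-injective : ∀ {a b} → from a ≡ from b → a ≡ b
  from-injective eq = trans (from≡⇒≡to eq) (sym (from≡⇒≡to refl))

  _≟ᶜ_ : (a b : Color) → Dec (a ≡ b)
  a ≟ᶜ b = map′ from-injective (cong from) (from a ≟ from b)

  cell : Fin h ⊎ Fin h′ → Fin n → Color
  cell (inj₁ i) x = [ inj₁ , (λ y → inj₂ (inj₁ (i , toℕ y mod g))) ]′ (splitAt w x)
  cell (inj₂ i) x = inj₂ (inj₂ (i , toℕ x mod c))

  cell-collision : ∀ r r′ x x′ → cell r x ≡ cell r′ x′ → r ≡ r′ ⊎ (0 < w × x ≡ x′)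
  cell-collision (inj₁ i) (inj₁ i′) x x′ eq with splitAt w x in ex | splitAt w x′ in ex′
  ... | inj₁ a | inj₁ a′ = inj₂ (Fin⇒>0 a , splitAt-injective w (trans ex (trans (cong inj₁ (inj₁-injective eq)) (sym ex′))))
  ... | inj₂ b | inj₂ b′ = inj₁ (cong inj₁ (,-injectiveˡ (inj₁-injective (inj₂-injective eq))))
  cell-collision (inj₁ i) (inj₂ i′) x x′ eq with splitAt w x | eq
  ... | inj₁ _ | ()
  ... | inj₂ _ | ()
  cell-collision (inj₂ i) (inj₁ i′) x x′ eq with splitAt w x′ | eq
  ... | inj₁ _ | ()
  ... | inj₂ _ | ()
  cell-collision (inj₂ i) (inj₂ i′) x x′ eq = inj₁ (cong inj₂ (,-injectiveˡ (inj₂-injective (inj₂-injective eq))))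

  row : Fin (m * n) → Fin m
  row v = proj₁ (remQuot {m} n v)

  col : Fin (m * n) → Fin n
  col v = proj₂ (remQuot {m} n v)

  coloring : Fin (m * n) → Fin k
  coloring v = from (cell (splitAt h (row v)) (col v))

  coloring-collision : ∀ u v → coloring u ≡ coloring v → row u ≡ row v ⊎ (0 < w × col u ≡ col v)
  coloring-collision u v eq with cell-collision _ _ (col u) (col v) (from-injective eq)
  ... | inj₁ same-part   = inj₁ (splitAt-injective h same-part)
  ... | inj₂ same-column = inj₂ same-column

  𝟙-pair : ∀ {A B : Set} (κ : A × B → Color) → (∀ {p q} → κ p ≡ κ q → p ≡ q) →
           ∀ {a a′ b b′} (da : Dec (a ≡ a′)) (db : Dec (b ≡ b′)) → 𝟙 (κ (a , b) ≟ᶜ κ (a′ , b′)) ≡ 𝟙 da * 𝟙 db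
  𝟙-pair κ κ-inj da db = trans
    (𝟙-cong (,-injective ∘ κ-inj) (λ (p , q) → cong₂ (λ a b → κ (a , b)) p q) (κ (_ , _) ≟ᶜ κ (_ , _)) (da ×-dec db))
    (𝟙-×-dec da db)

  topCount bottomCount : Color → ℕ
  topCount    a = ∑[ i < h ] (∑[ x < w ] 𝟙 (inj₁ x ≟ᶜ a) + ∑[ y < w′ ] 𝟙 (inj₂ (inj₁ (i , toℕ y mod g)) ≟ᶜ a))
  bottomCount a = ∑[ i < h′ ] ∑[ x < n ] 𝟙 (inj₂ (inj₂ (i , toℕ x mod c)) ≟ᶜ a)

  classSize-coloring : ∀ i → classSize coloring i ≡ topCount (to i) + bottomCount (to i)
  classSize-coloring i = begin
    classSize coloring i                                      ≡⟨ classSize≡∑ coloring i ⟩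
    ∑[ v < m * n ] 𝟙 (coloring v ≟ i)                        ≡⟨ sum-cong-≗ {m * n} (λ v →
         𝟙-cong from≡⇒≡to ≡to⇒from≡ (coloring v ≟ i) (cell (splitAt h (row v)) (col v) ≟ᶜ a)) ⟩
    ∑[ v < m * n ] 𝟙 (cell (splitAt h (row v)) (col v) ≟ᶜ a) ≡⟨ ∑-remQuot m n (λ (r , x) → 𝟙 (cell (splitAt h r) x ≟ᶜ a)) ⟩
    ∑[ r < m ] ∑[ x < n ] 𝟙 (cell (splitAt h r) x ≟ᶜ a)      ≡⟨ ∑-↑ h h′ _ ⟩
    ∑[ i < h ] ∑[ x < n ] 𝟙 (cell (splitAt h (i ↑ˡ h′)) x ≟ᶜ a) +
    ∑[ i < h′ ] ∑[ x < n ] 𝟙 (cell (splitAt h (h ↑ʳ i)) x ≟ᶜ a)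
      ≡⟨ cong₂ _+_ (sum-cong-≗ {h} top-i) (sum-cong-≗ {h′} λ i → sum-cong-≗ {n} λ x →
           cong (λ r → 𝟙 (cell r x ≟ᶜ a)) (splitAt-↑ʳ h h′ i)) ⟩
    topCount a + bottomCount a                                    ∎
    where
    open ≡-Reasoning
    a = to i
    top-i : ∀ i → ∑[ x < n ] 𝟙 (cell (splitAt h (i ↑ˡ h′)) x ≟ᶜ a)
                ≡ ∑[ x < w ] 𝟙 (inj₁ x ≟ᶜ a) + ∑[ y < w′ ] 𝟙 (inj₂ (inj₁ (i , toℕ y mod g)) ≟ᶜ a)
    top-i i rewrite splitAt-↑ˡ h i h′ = trans (∑-↑ w w′ _) (cong₂ _+_
      (sum-cong-≗ {w}  λ x → cong (λ s → 𝟙 ([ inj₁ , _ ]′ s ≟ᶜ a)) (splitAt-↑ˡ w x w′))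
      (sum-cong-≗ {w′} λ y → cong (λ s → 𝟙 ([ inj₁ , (λ y → inj₂ (inj₁ (i , toℕ y mod g))) ]′ s ≟ᶜ a)) (splitAt-↑ʳ w w′ y)))

  size-column : ∀ x₀ → topCount (inj₁ x₀) + bottomCount (inj₁ x₀) ≡ h
  size-column x₀ = begin
    topCount (inj₁ x₀) + bottomCount (inj₁ x₀)
      ≡⟨ cong₂ _+_ (sum-cong-≗ {h} λ i → cong₂ _+_
           (trans (sum-cong-≗ {w} λ x → 𝟙-cong inj₁-injective (cong inj₁) (inj₁ x ≟ᶜ inj₁ x₀) (x ≟ x₀)) (∑-𝟙≟ʳ x₀))
           (∑-zero {w′} _ λ y → 𝟙-no (λ ()) (inj₂ (inj₁ (i , toℕ y mod g)) ≟ᶜ inj₁ x₀)))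
         (∑-zero {h′} _ λ i → ∑-zero {n} _ λ x → 𝟙-no (λ ()) (inj₂ (inj₂ (i , toℕ x mod c)) ≟ᶜ inj₁ x₀)) ⟩
    ∑[ i < h ] 1 + 0 ≡⟨ trans (+-identityʳ _) (trans (∑-const h 1) (*-identityʳ h)) ⟩
    h                ∎
    where open ≡-Reasoning

  size-top : ∀ i₀ j → topCount (inj₂ (inj₁ (i₀ , j))) + bottomCount (inj₂ (inj₁ (i₀ , j))) ≡ Residues.count g j w′
  size-top i₀ j = begin
    topCount a + bottomCount a
      ≡⟨ cong₂ _+_ (sum-cong-≗ {h} λ i → cong₂ _+_
           (∑-zero {w} _ λ x → 𝟙-no (λ ()) (inj₁ x ≟ᶜ a))
           (trans (sum-cong-≗ {w′} λ y → 𝟙-pair (inj₂ ∘ inj₁) (inj₁-injective ∘ inj₂-injective) (i ≟ i₀) (toℕ y mod g ≟ j))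
                  (sym (*-distribˡ-sum {w′} (𝟙 (i ≟ i₀)) (λ y → 𝟙 (toℕ y mod g ≟ j))))))
         (∑-zero {h′} _ λ i → ∑-zero {n} _ λ x → 𝟙-no (λ ()) (inj₂ (inj₂ (i , toℕ x mod c)) ≟ᶜ a)) ⟩
    ∑[ i < h ] (𝟙 (i ≟ i₀) * count w′) + 0 ≡⟨ trans (+-identityʳ _) (∑-𝟙≟-sift i₀ (λ _ → count w′)) ⟩
    count w′                               ∎
    where
    open ≡-Reasoning
    open Residues g j
    a = inj₂ (inj₁ (i₀ , j))

  size-bottom : ∀ i₀ j → topCount (inj₂ (inj₂ (i₀ , j))) + bottomCount (inj₂ (inj₂ (i₀ , j))) ≡ Residues.count c j n
  size-bottom i₀ j = begin
    topCount a + bottomCount a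
      ≡⟨ cong₂ _+_ (∑-zero {h} _ λ i → cong₂ _+_
           (∑-zero {w} _ λ x → 𝟙-no (λ ()) (inj₁ x ≟ᶜ a))
           (∑-zero {w′} _ λ y → 𝟙-no (λ ()) (inj₂ (inj₁ (i , toℕ y mod g)) ≟ᶜ a)))
         (sum-cong-≗ {h′} λ i →
           trans (sum-cong-≗ {n} λ x → 𝟙-pair (inj₂ ∘ inj₂) (inj₂-injective ∘ inj₂-injective) (i ≟ i₀) (toℕ x mod c ≟ j))
                 (sym (*-distribˡ-sum {n} (𝟙 (i ≟ i₀)) (λ x → 𝟙 (toℕ x mod c ≟ j))))) ⟩
    ∑[ i < h′ ] (𝟙 (i ≟ i₀) * count n) ≡⟨ ∑-𝟙≟-sift i₀ (λ _ → count n) ⟩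
    count n                             ∎
    where
    open ≡-Reasoning
    open Residues c j
    a = inj₂ (inj₂ (i₀ , j))

  coloring-near : ∀ i → Near t (classSize coloring i)
  coloring-near i = subst (Near t) (sym (classSize-coloring i)) (near (to i))
    where
    near : ∀ a → Near t (topCount a + bottomCount a)
    near (inj₁ x₀)              = subst (Near t) (sym (size-column x₀)) (columns (Fin⇒>0 x₀))
    near (inj₂ (inj₁ (i₀ , j))) = subst (Near t) (sym (size-top i₀ j)) (Residues.count-near g j (top (Fin⇒>0 i₀)))
    near (inj₂ (inj₂ (i₀ , j))) = subst (Near t) (sym (size-bottom i₀ j)) (Residues.count-near c j (bottom (Fin⇒>0 i₀)))

  KmxKn-equitable : HasEquitableColoring 1 (KmxKn m n) k
  KmxKn-equitable = coloring , proper , Near⇒balanced (classSize coloring) coloring-near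
    where
    proper : IsColoring (KmxKn m n) k coloring
    proper u v (different-row , different-column) same-color with coloring-collision u v same-color
    ... | inj₁ same-row         = different-row same-row
    ... | inj₂ (_ , same-column) = different-column same-column

  Kmn-partite-equitable : w ≡ 0 → HasEquitableColoring 1 (Kmn-partite m n) k
  Kmn-partite-equitable refl = coloring , proper , Near⇒balanced (classSize coloring) coloring-near
    where
    proper : IsColoring (Kmn-partite m n) k coloring
    proper u v different-part same-color with coloring-collision u v same-color
    ... | inj₁ same-part = different-part same-part

ceiling : ∀ n d .{{_ : NonZero d}} → 0 < n → Σ[ c₀ ∈ ℕ ] c₀ * d < n × n ≤ suc c₀ * d
ceiling (suc n) d _ = n / d , s≤s (m/n*n≤m n d) , (begin
  suc n                   ≡⟨ cong suc (m≡m%n+[m/n]*n n d) ⟩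
  suc (n % d + n / d * d) ≤⟨ +-monoˡ-≤ (n / d * d) (m%n<n n d) ⟩
  d + n / d * d           ∎)
  where open ≤-Reasoning

Kmn-partite-equitable-+ : ∀ {m n} e d σ .{{_ : NonZero d}} → e ≤ m → Splits (suc d) σ n → Splits d σ n →
                          HasEquitableColoring 1 (Kmn-partite m n) (e + d * m)
Kmn-partite-equitable-+ {m} {n} e d σ e≤m splits-1+d splits-d =
  subst₂ (λ m k → HasEquitableColoring 1 (Kmn-partite m n) k) (m+[n∸m]≡n e≤m) colors
    (BlockColoring.Kmn-partite-equitable e (m ∸ e) 0 n (suc d) d σ (λ ()) (λ _ → splits-1+d) (λ _ → splits-d) refl)
  where
  colors : e * suc d + (m ∸ e) * d ≡ e + d * m
  colors = trans (distrib e (m ∸ e) d) (cong (λ m → e + d * m) (m+[n∸m]≡n e≤m))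
    where
    distrib : ∀ e f d → e * suc d + f * d ≡ e + d * (e + f)
    distrib = solve-∀

-- Write b = e + d·m with d > c₀: e parts get d + 1 classes, the others d.
Kmn-partite-equitable-≥ : ∀ {m n b} (S : Splitting (suc m) n (suc b)) c₀ → let open Splitting S in
                          n ≤ suc c₀ * suc σ → suc m * suc c₀ ≤ b → HasEquitableColoring 1 (Kmn-partite (suc m) n) b
Kmn-partite-equitable-≥ {m} {n} {b} S c₀ n≤[1+c₀][1+σ] M[1+c₀]≤b =
  subst (HasEquitableColoring 1 (Kmn-partite M n)) (sym b≡)
    (Kmn-partite-equitable-+ e d σ {{>-nonZero (<-≤-trans z<s 1+c₀≤d)}} (<⇒≤ (m%n<n b M))
      (splits-1+d , n≤[1+d][1+σ]) (splits-d , n≤d[1+σ]))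
  where
  open Splitting S
  open ≤-Reasoning
  M = suc m
  d = b / M
  e = b % M
  b≡ : b ≡ e + d * M
  b≡ = m≡m%n+[m/n]*n b M
  1+c₀≤d : suc c₀ ≤ d
  1+c₀≤d = s≤s⁻¹ (*-cancelʳ-< M (suc c₀) (suc d) (begin-strict
    suc c₀ * M ≡⟨ *-comm (suc c₀) M ⟩
    M * suc c₀ ≤⟨ M[1+c₀]≤b ⟩
    b          ≡⟨ b≡ ⟩
    e + d * M  <⟨ +-monoˡ-< (d * M) (m%n<n b M) ⟩
    suc d * M  ∎))
  fat-part = pigeonhole-> classesIn d (begin-strict
    M * d      ≡⟨ *-comm M d ⟩
    d * M      ≤⟨ m≤n+m (d * M) e ⟩
    e + d * M  ≡⟨ b≡ ⟨
    b          <⟨ n<1+n b ⟩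
    suc b      ≡⟨ ∑classesIn ⟨
    sum classesIn  ∎)
  splits-1+d : suc d * σ ≤ n
  splits-1+d = let i , d<classesIn-i = fat-part in ≤-trans (*-monoˡ-≤ σ d<classesIn-i) (proj₁ (splits i))
  splits-d : d * σ ≤ n
  splits-d = ≤-trans (*-monoˡ-≤ σ (n≤1+n d)) splits-1+d
  n≤d[1+σ] : n ≤ d * suc σ
  n≤d[1+σ] = ≤-trans n≤[1+c₀][1+σ] (*-monoˡ-≤ (suc σ) 1+c₀≤d)
  n≤[1+d][1+σ] : n ≤ suc d * suc σ
  n≤[1+d][1+σ] = ≤-trans n≤d[1+σ] (*-monoˡ-≤ (suc σ) (n≤1+n d))

Kmn-partite-not-equitable : ∀ m n → let M = suc m; q = n / suc M; r = n % suc M in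
                            0 < r → r < M → ¬ HasEquitableColoring 1 (Kmn-partite M n) (q + m * suc q)
Kmn-partite-not-equitable m n 0<r r<M has-K = <⇒≱ Mn<K[1+M] K[1+M]≤Mn
  where
  open Splitting (equitable⇒Splitting {m} {n} has-K)
  open ≤-Reasoning
  M = suc m
  q = n / suc M
  r = n % suc M
  K = q + m * suc q
  n≡r+q[1+M] : n ≡ r + q * suc M
  n≡r+q[1+M] = m≡m%n+[m/n]*n n (suc M)
  thin-part = pigeonhole-< classesIn (suc q) (subst (_< M * suc q) (sym ∑classesIn) ≤-refl)
  M<σ : M < σ
  M<σ = let i , classesIn-i≤q = thin-part in s≤s⁻¹ (*-cancelˡ-< q (suc M) (suc σ) (begin-strict
    q * suc M      <⟨ m<n+m (q * suc M) 0<r ⟩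
    r + q * suc M  ≡⟨ n≡r+q[1+M] ⟨
    n              ≤⟨ proj₂ (splits i) ⟩
    classesIn i * suc σ ≤⟨ *-monoˡ-≤ (suc σ) (s≤s⁻¹ classesIn-i≤q) ⟩
    q * suc σ      ∎))
  K[1+M]≤Mn : K * suc M ≤ M * n
  K[1+M]≤Mn = begin
    K * suc M  ≤⟨ *-monoʳ-≤ K M<σ ⟩
    K * σ      ≡⟨ cong (_* σ) ∑classesIn ⟨
    sum classesIn * σ ≤⟨ ∑-*-≤ classesIn σ n (proj₁ ∘ splits) ⟩
    M * n      ∎
  Mn<K[1+M] : M * n < K * suc M
  Mn<K[1+M] = begin-strict
    M * n                   ≡⟨ cong (M *_) n≡r+q[1+M] ⟩
    M * (r + q * suc M)     ≤⟨ *-monoʳ-≤ M (+-monoˡ-≤ (q * suc M) (s≤s⁻¹ r<M)) ⟩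
    M * (m + q * suc M)     <⟨ m<m+n _ (≤-trans 0<r (s≤s⁻¹ r<M)) ⟩
    M * (m + q * suc M) + m ≡⟨ expand m q ⟨
    K * suc M               ∎
    where
    expand : ∀ m q → (q + m * suc q) * suc (suc m) ≡ suc m * (m + q * suc (suc m)) + m
    expand = solve-∀

-- s + 1 rows sharing s column colours save one colour on m(c₀ + 1).
KmxKn-equitable-block : ∀ {m n b} s c₀ t .{{_ : NonZero c₀}} → suc s ≤ m → s ≤ n →
                        Near t (suc s) → Splits c₀ t (n ∸ s) → Splits (suc c₀) t n → suc b ≡ m * suc c₀ →
                        HasEquitableColoring 1 (KmxKn m n) b
KmxKn-equitable-block {m} {n} {b} s c₀ t 1+s≤m s≤n near top bottom 1+b≡m[1+c₀] =
  subst₂ (λ m n → HasEquitableColoring 1 (KmxKn m n) b) (m+[n∸m]≡n 1+s≤m) (m+[n∸m]≡n s≤n)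
    (subst (HasEquitableColoring 1 (KmxKn _ _)) colors
      (BlockColoring.KmxKn-equitable (suc s) (m ∸ suc s) s (n ∸ s) c₀ (suc c₀) t
        (λ _ → near) (λ _ → top) (λ _ → subst (Splits (suc c₀) t) (sym (m+[n∸m]≡n s≤n)) bottom)))
  where
  open ≡-Reasoning
  colors : s + (suc s * c₀ + (m ∸ suc s) * suc c₀) ≡ b
  colors = suc-injective (begin
    suc (s + (suc s * c₀ + (m ∸ suc s) * suc c₀)) ≡⟨ distrib s c₀ (m ∸ suc s) ⟩
    (suc s + (m ∸ suc s)) * suc c₀                ≡⟨ cong (_* suc c₀) (m+[n∸m]≡n 1+s≤m) ⟩
    m * suc c₀                                    ≡⟨ 1+b≡m[1+c₀] ⟨
    suc b                                         ∎)
    where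
    distrib : ∀ s c₀ f → suc (s + (suc s * c₀ + f * suc c₀)) ≡ (suc s + f) * suc c₀
    distrib = solve-∀

KmxKn-equitable-ρ≡1+σ : ∀ {m b} σ c₀ .{{_ : NonZero c₀}} → σ < m → suc b ≡ m * suc c₀ →
                        HasEquitableColoring 1 (KmxKn m (suc σ + c₀ * suc σ)) b
KmxKn-equitable-ρ≡1+σ σ c₀ σ<m =
  KmxKn-equitable-block σ c₀ (suc σ) σ<m (≤-trans (n≤1+n σ) (m≤m+n _ _)) (≤-refl , n≤1+n _)
    (subst (Splits c₀ (suc σ)) (sym n∸σ≡)
      (n≤1+n _ , subst (suc (c₀ * suc σ) ≤_) (sym (*-suc c₀ (suc σ))) (+-monoˡ-≤ _ (>-nonZero⁻¹ c₀))))
    (≤-refl , *-monoʳ-≤ (suc c₀) (n≤1+n (suc σ)))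
  where
  n∸σ≡ : suc σ + c₀ * suc σ ∸ σ ≡ suc (c₀ * suc σ)
  n∸σ≡ = trans (cong (_∸ σ) (sym (+-suc σ (c₀ * suc σ)))) (m+n∸m≡n σ _)

KmxKn-equitable-ρ≡σ : ∀ {m b} σ c₀ .{{_ : NonZero c₀}} → σ < m → suc b ≡ m * suc c₀ →
                      HasEquitableColoring 1 (KmxKn m (σ + c₀ * suc σ)) b
KmxKn-equitable-ρ≡σ σ c₀ σ<m =
  KmxKn-equitable-block σ c₀ σ σ<m (m≤m+n _ _) (n≤1+n σ , ≤-refl)
    (subst (Splits c₀ σ) (sym (m+n∸m≡n σ _)) (*-monoʳ-≤ c₀ (n≤1+n σ) , ≤-refl))
    (+-monoʳ-≤ σ (*-monoʳ-≤ c₀ (n≤1+n σ)) , n≤1+n _)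

KmxKn-equitable-ρ<σ : ∀ {m b} σ c₀ ρ .{{_ : NonZero c₀}} → σ ≤ m → ρ < σ → suc c₀ * σ ≤ ρ + c₀ * suc σ →
                      suc b ≡ m * suc c₀ → HasEquitableColoring 1 (KmxKn m (ρ + c₀ * suc σ)) b
KmxKn-equitable-ρ<σ (suc s) c₀ ρ 1+s≤m (s≤s ρ≤s) lower =
  KmxKn-equitable-block s c₀ (suc s) 1+s≤m (≤-trans (n≤1+n s) (≤-trans (m≤m+n _ _) lower)) (≤-refl , n≤1+n _)
    ( m+n≤o⇒m≤o∸n (c₀ * suc s) (≤-trans (≤-reflexive (+-comm (c₀ * suc s) s)) (≤-trans (n≤1+n _) lower))
    , m≤n+o⇒m∸n≤o _ s (+-monoˡ-≤ _ ρ≤s))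
    (lower , +-monoˡ-≤ _ (≤-trans ρ≤s (≤-trans (n≤1+n s) (n≤1+n (suc s)))))

-- ρ = n − c₀(σ + 1) ∈ {σ + 1, σ} would mean n ≡ 0 or n ≡ m (mod m + 1) when
-- σ = m; this is where 0 < r < m is used.
KmxKn-equitable-pred : ∀ {m n b} σ c₀ .{{_ : NonZero c₀}} → σ ≤ m → 0 < n % suc m → n % suc m < m →
                       c₀ * suc σ ≤ n → n ≤ suc c₀ * suc σ → suc c₀ * σ ≤ n → suc b ≡ m * suc c₀ →
                       HasEquitableColoring 1 (KmxKn m n) b
KmxKn-equitable-pred {m} {n} {b} σ c₀ σ≤m 0<r r<m c₀[1+σ]≤n n≤[1+c₀][1+σ] [1+c₀]σ≤n 1+b≡ =
  by-overshoot (m≤n⇒m<n∨m≡n ρ≤1+σ)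
  where
  ρ = n ∸ c₀ * suc σ
  n≡ : n ≡ ρ + c₀ * suc σ
  n≡ = sym (m∸n+n≡m c₀[1+σ]≤n)
  ρ≤1+σ : ρ ≤ suc σ
  ρ≤1+σ = +-cancelʳ-≤ (c₀ * suc σ) ρ (suc σ) (subst (_≤ suc c₀ * suc σ) n≡ n≤[1+c₀][1+σ])
  overshoot-is : ∀ {ρ′} → ρ ≡ ρ′ → n ≡ ρ′ + c₀ * suc σ
  overshoot-is ρ≡ρ′ = trans n≡ (cong (_+ c₀ * suc σ) ρ≡ρ′)
  by-overshoot : ρ < suc σ ⊎ ρ ≡ suc σ → HasEquitableColoring 1 (KmxKn m n) b
  by-overshoot (inj₂ ρ≡1+σ) = subst (λ n → HasEquitableColoring 1 (KmxKn m n) b) (sym n≡[1+c₀][1+σ])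
    (KmxKn-equitable-ρ≡1+σ σ c₀ (≤∧≢⇒< σ≤m σ≢m) 1+b≡)
    where
    n≡[1+c₀][1+σ] = overshoot-is ρ≡1+σ
    σ≢m : σ ≢ m
    σ≢m σ≡m = <⇒≢ 0<r (sym (trans (cong (_% suc m) (trans n≡[1+c₀][1+σ] (cong (λ σ → suc c₀ * suc σ) σ≡m)))
                                  (m*n%n≡0 (suc c₀) (suc m))))
  by-overshoot (inj₁ ρ<1+σ) with m≤n⇒m<n∨m≡n (s≤s⁻¹ ρ<1+σ)
  ... | inj₂ ρ≡σ = subst (λ n → HasEquitableColoring 1 (KmxKn m n) b) (sym n≡σ+c₀[1+σ])
    (KmxKn-equitable-ρ≡σ σ c₀ (≤∧≢⇒< σ≤m σ≢m) 1+b≡)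
    where
    n≡σ+c₀[1+σ] = overshoot-is ρ≡σ
    σ≢m : σ ≢ m
    σ≢m σ≡m = <⇒≢ r<m (trans (cong (_% suc m) (trans n≡σ+c₀[1+σ] (cong (λ σ → σ + c₀ * suc σ) σ≡m)))
                            (trans ([m+kn]%n≡m%n m c₀ (suc m)) (m<n⇒m%n≡m (n<1+n m))))
  ... | inj₁ ρ<σ = subst (λ n → HasEquitableColoring 1 (KmxKn m n) b) (sym n≡)
    (KmxKn-equitable-ρ<σ σ c₀ ρ σ≤m ρ<σ (subst (suc c₀ * σ ≤_) n≡ [1+c₀]σ≤n) 1+b≡)

module _ {m n : ℕ} (M≤n : suc m ≤ n) (0<r : 0 < n % suc (suc m)) (r<M : n % suc (suc m) < suc m) where

  private
    M = suc m
    q = n / suc M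

  KmxKn-equitable-below : ∀ {b} → HasEquitableColoring 1 (Kmn-partite M n) (suc b) →
                          ¬ HasEquitableColoring 1 (Kmn-partite M n) b → M * suc q ≤ suc b →
                          HasEquitableColoring 1 (KmxKn M n) b
  KmxKn-equitable-below {b} has-1+b ¬has-b M[1+q]≤1+b =
    KmxKn-equitable-pred σ c₀ {{>-nonZero (≤-trans 1≤q (s≤s⁻¹ 1+q≤1+c₀))}} σ≤M 0<r r<M
      (<⇒≤ c₀[1+σ]<n) n≤[1+c₀][1+σ] [1+c₀]σ≤n 1+b≡M[1+c₀]
    where
    S = equitable⇒Splitting {m} {n} has-1+b
    open Splitting S
    open ≤-Reasoning
    n≡ : n ≡ n % suc M + q * suc M
    n≡ = m≡m%n+[m/n]*n n (suc M)
    ⌈n/[1+σ]⌉ = ceiling n (suc σ) (<-≤-trans 0<r (m%n≤m n (suc M)))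
    c₀ = proj₁ ⌈n/[1+σ]⌉
    c₀[1+σ]<n = proj₁ (proj₂ ⌈n/[1+σ]⌉)
    n≤[1+c₀][1+σ] = proj₂ (proj₂ ⌈n/[1+σ]⌉)
    c₀<classesIn : ∀ i → c₀ < classesIn i
    c₀<classesIn i = *-cancelʳ-< (suc σ) c₀ (classesIn i) (<-≤-trans c₀[1+σ]<n (proj₂ (splits i)))
    1+b≡M[1+c₀] : suc b ≡ M * suc c₀
    1+b≡M[1+c₀] with M * suc c₀ ≤? b
    ... | yes M[1+c₀]≤b = contradiction (Kmn-partite-equitable-≥ S c₀ n≤[1+c₀][1+σ] M[1+c₀]≤b) ¬has-b
    ... | no  M[1+c₀]≰b =
      ≤-antisym (≰⇒> M[1+c₀]≰b) (subst (M * suc c₀ ≤_) ∑classesIn (*≤∑ classesIn (suc c₀) c₀<classesIn))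
    1+q≤1+c₀ : suc q ≤ suc c₀
    1+q≤1+c₀ = *-cancelˡ-≤ M (subst (M * suc q ≤_) 1+b≡M[1+c₀] M[1+q]≤1+b)
    1≤q : 1 ≤ q
    1≤q = n≢0⇒n>0 λ q≡0 → <⇒≱ r<M (≤-trans M≤n (≤-reflexive
            (trans n≡ (trans (cong (λ q → n % suc M + q * suc M) q≡0) (+-identityʳ _)))))
    [1+c₀]σ≤n : suc c₀ * σ ≤ n
    [1+c₀]σ≤n = ≤-trans (*-monoˡ-≤ σ (c₀<classesIn zero)) (proj₁ (splits zero))
    σ≤M : σ ≤ M
    σ≤M = s≤s⁻¹ (*-cancelˡ-< (suc c₀) σ (suc M) (begin-strict
      suc c₀ * σ             ≤⟨ [1+c₀]σ≤n ⟩
      n                      ≡⟨ n≡ ⟩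
      n % suc M + q * suc M  <⟨ +-monoˡ-< (q * suc M) (m<n⇒m<1+n r<M) ⟩
      suc q * suc M          ≤⟨ *-monoˡ-≤ (suc M) 1+q≤1+c₀ ⟩
      suc c₀ * suc M         ∎))

  eqThreshold-KmxKn<Kmn-partite : ∀ {a b} → IsEqThreshold 1 (KmxKn M n) a → IsEqThreshold 1 (Kmn-partite M n) b → a < b
  eqThreshold-KmxKn<Kmn-partite {b = zero} _ (() , _)
  eqThreshold-KmxKn<Kmn-partite {a} {suc b} a-threshold b-threshold@(_ , from-1+b , _) =
    threshold-< a-threshold b-threshold Kmn-partite⇒KmxKn 1≤b
      (KmxKn-equitable-below (from-1+b (suc b) ≤-refl)
        (¬equitable-pred-threshold 1 (Kmn-partite M n) b-threshold 1≤b) K<1+b)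
    where
    K<1+b : q + m * suc q < suc b
    K<1+b = ¬equitable⇒<threshold 1 (Kmn-partite M n) b-threshold (Kmn-partite-not-equitable m n 0<r r<M)
    1≤b : 1 ≤ b
    1≤b = ≤-trans (≤-trans (<-≤-trans 0<r (s≤s⁻¹ r<M)) (≤-trans (m≤m*n m (suc q)) (m≤n+m _ q))) (s≤s⁻¹ K<1+b)

corollary5 : (m n : ℕ) → m ≤ n → 2 ≤ n % suc m → n % suc m ≤ m ∸ 1 →
             Σ[ a ∈ ℕ ] Σ[ b ∈ ℕ ] (IsEqThreshold 1 (KmxKn m n) a ×
               IsEqThreshold 1 (Kmn-partite m n) b × a < b)
corollary5 zero    n _   2≤r r≤0 = contradiction (≤-trans 2≤r r≤0) λ ()
corollary5 (suc m) n M≤n 2≤r r≤m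
  with a , a-threshold ← threshold-exists 1 (KmxKn (suc m) n) (KmxKn-Adj? (suc m) n) ≤-refl KmxKn-irreflexive
     | b , b-threshold ← threshold-exists 1 (Kmn-partite (suc m) n) (Kmn-partite-Adj? (suc m) n) ≤-refl Kmn-partite-irreflexive
  = a , b , a-threshold , b-threshold ,
    eqThreshold-KmxKn<Kmn-partite M≤n (<-≤-trans z<s 2≤r) (s≤s r≤m) a-threshold b-threshold
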